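{- If $\Psi;\Gamma\vdash_0 t:T$, then $\mathrm{core}\,T$. If $\Psi;\Gamma\vdash_1 t:T$, then $\mathrm{type}\,T$.
   Context: Types: $T::=\mathsf{Nat}\mid\square T\mid S\to T$. $\mathrm{core}\,T$: $T$ built from $\mathsf{Nat}$ and $\to$ only. $\mathrm{type}\,T$: $\mathsf{Nat}$; $S\to T$ with $S,T$ valid; $\square T$ with $\mathrm{core}\,T$. Local contexts $\Gamma::=\cdot\mid\Gamma,x:T$, global contexts $\Psi::=\cdot\mid\Psi,u:T$; $\mathrm{core},\mathrm{type}$ extend pointwise. Terms $t::=x\mid u\mid\mathsf{zero}\mid\mathsf{succ}\,t\mid\mathsf{box}\,t\mid\mathsf{letbox}\,u=s\,\mathsf{in}\,t\mid\lambda x.t\mid s\ t$. Typing $\Psi;\Gamma\vdash_i t:T$ ($i\in\{0,1\}$), with $C_0$="$\mathrm{core}\,\Psi$, $\mathrm{core}\,\Gamma$", $C_1$="$\mathrm{core}\,\Psi$, $\mathrm{type}\,\Gamma$": under $C_i$, $\vdash_i\mathsf{zero}:\mathsf{Nat}$, $\vdash_i u:T$ for $u:T\in\Psi$, $\vdash_i x:T$ for $x:T\in\Gamma$; succ preserves $\mathsf{Nat}$ at layer $i$; $\Psi;\Gamma,x:S\vdash_i t:T\Rightarrow\Psi;\Gamma\vdash_i\lambda x.t:S\to T$; application at layer $i$; $\mathrm{type}\,\Gamma$ and $\Psi;\cdot\vdash_0 t:T$ give $\Psi;\Gamma\vdash_1\mathsf{box}\,t:\square T$; $\Psi;\Gamma\vdash_1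 s:\square T$ and $\Psi,u:T;\Gamma\vdash_1 t:T'$ give $\Psi;\Gamma\vdash_1\mathsf{letbox}\,u=s\,\mathsf{in}\,t:T'$. -}

module Defs where

open import Data.Nat using (ℕ)
open import Data.Product using (_×_; _,_)
open import Data.List using (List; []; _∷_)
open import Data.List.Relation.Unary.All using (All)
open import Data.List.Membership.Propositional using (_∈_)

data Ty : Set where
  Nat  : Ty
  □_   : Ty → Ty
  _⇒_  : Ty → Ty → Ty

infixr 5 _⇒_

data Core : Ty → Set where
  core-Nat : Core Nat
  core-⇒   : ∀ {S T} → Core S → Core T → Core (S ⇒ T)

data Type : Ty → Set where
  type-Nat : Type Nat
  type-⇒   : ∀ {S T} → Type S → Type T → Type (S ⇒ T)
  type-□   : ∀ {T} → Core T → Type (□ T)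

Name : Set
Name = ℕ

-- Contexts as snoc-lists; represented as lists with the most recent binding at the head.
Ctx : Set
Ctx = List (Name × Ty)

CtxP : (Ty → Set) → Ctx → Set
CtxP P = All (λ b → P (Data.Product.proj₂ b))
  where import Data.Product

_∶_∈_ : Name → Ty → Ctx → Set
x ∶ T ∈ Γ = (x , T) ∈ Γ

_,,_∶_ : Ctx → Name → Ty → Ctx
Γ ,, x ∶ T = (x , T) ∷ Γ

data Tm : Set where
  var    : Name → Tm
  gvar   : Name → Tm
  zero   : Tm
  succ   : Tm → Tm
  box    : Tm → Tm
  letbox : Name → Tm → Tm → Tm
  lam    : Name → Tm → Tm
  app    : Tm → Tm → Tm

data Layer : Set where
  L0 L1 : Layer

Cond : Layer → Ctx → Ctx → Set
Cond L0 Ψ Γ = CtxP Core Ψ × CtxP Core Γ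
Cond L1 Ψ Γ = CtxP Core Ψ × CtxP Type Γ

data _︔_⊢[_]_∶_ : Ctx → Ctx → Layer → Tm → Ty → Set where
  t-zero : ∀ {i Ψ Γ} → Cond i Ψ Γ → Ψ ︔ Γ ⊢[ i ] zero ∶ Nat
  t-gvar : ∀ {i Ψ Γ u T} → Cond i Ψ Γ → u ∶ T ∈ Ψ → Ψ ︔ Γ ⊢[ i ] gvar u ∶ T
  t-var  : ∀ {i Ψ Γ x T} → Cond i Ψ Γ → x ∶ T ∈ Γ → Ψ ︔ Γ ⊢[ i ] var x ∶ T
  t-succ : ∀ {i Ψ Γ t} → Ψ ︔ Γ ⊢[ i ] t ∶ Nat → Ψ ︔ Γ ⊢[ i ] succ t ∶ Nat
  t-lam  : ∀ {i Ψ Γ x t S T} → Ψ ︔ (Γ ,, x ∶ S) ⊢[ i ] t ∶ T → Ψ ︔ Γ ⊢[ i ] lam x t ∶ (S ⇒ T)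
  t-app  : ∀ {i Ψ Γ s t S T} → Ψ ︔ Γ ⊢[ i ] s ∶ (S ⇒ T) → Ψ ︔ Γ ⊢[ i ] t ∶ S
         → Ψ ︔ Γ ⊢[ i ] app s t ∶ T
  t-box  : ∀ {Ψ Γ t T} → CtxP Type Γ → Ψ ︔ [] ⊢[ L0 ] t ∶ T → Ψ ︔ Γ ⊢[ L1 ] box t ∶ (□ T)
  t-letbox : ∀ {Ψ Γ u s t T T′} → Ψ ︔ Γ ⊢[ L1 ] s ∶ (□ T) → (Ψ ,, u ∶ T) ︔ Γ ⊢[ L1 ] t ∶ T′
           → Ψ ︔ Γ ⊢[ L1 ] letbox u s t ∶ T′

module Submission where

open import Defs
open import Data.Product using (_×_; _,_; proj₁; proj₂)
open import Data.List.Relation.Unary.All using (_∷_; lookup)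

-- Every derivation presupposes its context condition C_i: the axioms carry
-- it, and t-box recovers it from the core Ψ of its layer-0 premise together
-- with its explicit type Γ. With the types of all variables thus valid (core
-- at layer 0), the theorem is a direct induction on derivations.

Core⇒Type : ∀ {T} → Core T → Type T
Core⇒Type core-Nat     = type-Nat
Core⇒Type (core-⇒ S T) = type-⇒ (Core⇒Type S) (Core⇒Type T)

Cond-unbind : ∀ i {Ψ Γ x S} → Cond i Ψ (Γ ,, x ∶ S) → Cond i Ψ Γ
Cond-unbind L0 (Ψ-core , _ ∷ Γ-core) = Ψ-core , Γ-core
Cond-unbind L1 (Ψ-core , _ ∷ Γ-type) = Ψ-core , Γ-type

⊢⇒Cond : ∀ {i Ψ Γ t T} → Ψ ︔ Γ ⊢[ i ] t ∶ T → Cond i Ψ Γ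
⊢⇒Cond (t-zero c)       = c
⊢⇒Cond (t-gvar c _)     = c
⊢⇒Cond (t-var c _)      = c
⊢⇒Cond (t-succ d)       = ⊢⇒Cond d
⊢⇒Cond {i} (t-lam d)    = Cond-unbind i (⊢⇒Cond d)
⊢⇒Cond (t-app d _)      = ⊢⇒Cond d
⊢⇒Cond (t-box Γ-type d) = proj₁ (⊢⇒Cond d) , Γ-type
⊢⇒Cond (t-letbox d _)   = ⊢⇒Cond d

bound-Core : ∀ {Ψ Γ x S t T} → Ψ ︔ (Γ ,, x ∶ S) ⊢[ L0 ] t ∶ T → Core S
bound-Core d with ⊢⇒Cond d
... | _ , S-core ∷ _ = S-core

bound-Type : ∀ {Ψ Γ x S t T} → Ψ ︔ (Γ ,, x ∶ S) ⊢[ L1 ] t ∶ T → Type S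
bound-Type d with ⊢⇒Cond d
... | _ , S-type ∷ _ = S-type

codomain-Core : ∀ {S T} → Core (S ⇒ T) → Core T
codomain-Core (core-⇒ _ T) = T

codomain-Type : ∀ {S T} → Type (S ⇒ T) → Type T
codomain-Type (type-⇒ _ T) = T

⊢₀⇒Core : ∀ {Ψ Γ t T} → Ψ ︔ Γ ⊢[ L0 ] t ∶ T → Core T
⊢₀⇒Core (t-zero _)                       = core-Nat
⊢₀⇒Core (t-gvar (Ψ-core , _) u∈Ψ)        = lookup Ψ-core u∈Ψ
⊢₀⇒Core (t-var (_ , Γ-core) x∈Γ)         = lookup Γ-core x∈Γ
⊢₀⇒Core (t-succ _)                       = core-Nat
⊢₀⇒Core (t-lam d)                        = core-⇒ (bound-Core d) (⊢₀⇒Core d)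
⊢₀⇒Core (t-app d _)                      = codomain-Core (⊢₀⇒Core d)

⊢₁⇒Type : ∀ {Ψ Γ t T} → Ψ ︔ Γ ⊢[ L1 ] t ∶ T → Type T
⊢₁⇒Type (t-zero _)                       = type-Nat
⊢₁⇒Type (t-gvar (Ψ-core , _) u∈Ψ)        = Core⇒Type (lookup Ψ-core u∈Ψ)
⊢₁⇒Type (t-var (_ , Γ-type) x∈Γ)         = lookup Γ-type x∈Γ
⊢₁⇒Type (t-succ _)                       = type-Nat
⊢₁⇒Type (t-lam d)                        = type-⇒ (bound-Type d) (⊢₁⇒Type d)
⊢₁⇒Type (t-app d _)                      = codomain-Type (⊢₁⇒Type d)
⊢₁⇒Type (t-box _ d)                      = type-□ (⊢₀⇒Core d)
⊢₁⇒Type (t-letbox _ d)                   = ⊢₁⇒Type d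

mainTheorem4 : (∀ {Ψ Γ t T} → Ψ ︔ Γ ⊢[ L0 ] t ∶ T → Core T)
    × (∀ {Ψ Γ t T} → Ψ ︔ Γ ⊢[ L1 ] t ∶ T → Type T)
mainTheorem4 = ⊢₀⇒Core , ⊢₁⇒Type
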